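{- A finite poset $P$ is LE-cactus if and only if every order ideal $I$ of $P$ (with the induced order) is LE-cactus.
   Context: For an $n$-element poset $P$, a linear extension is a list $(p_1,\dots,p_n)$ of all elements with $p_a<_P p_b$ implying $a<b$; ${\mathcal{L}}(P)$ is the set of these. The Bender--Knuth move $t_i$ ($1\le i\le n-1$) acts on ${\mathcal{L}}(P)$ by swapping $p_i,p_{i+1}$ if incomparable and fixing the list otherwise; $\mathcal{BK}_P$ is the permutation group they generate. Let $q_m=t_1(t_2t_1)\cdots(t_mt_{m-1}\cdots t_1)$ and $q_{jk}=q_{k-1}q_{k-j}q_{k-1}$. An $n$-element poset is LE-cactus if $(t_iq_{jk})^2=1$ holds in $\mathcal{BK}_P$ for all $2\le i+1<j<k\le n$. An order ideal is a subset closed under going down. -}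

module Defs where

open import Level using (0ℓ)
open import Data.Nat as ℕ using (ℕ; zero; suc; _+_; _∸_)
open import Data.Fin as Fin using (Fin)
open import Data.Fin.Subset as Sub using (Subset)
open import Data.List using (List; []; _∷_; length; lookup; _++_)
open import Data.List.Membership.Propositional as LMem using ()
open import Data.List.Relation.Unary.Unique.Propositional using (Unique)
open import Data.Product using (_×_; Σ)
open import Relation.Nullary using (¬_; yes; no)
open import Relation.Binary using (Rel; IsDecPartialOrder)
open import Relation.Binary.PropositionalEquality using (_≡_; _≢_)
open import Function using (_⇔_)

record FinPoset : Set₁ where
  field
    n                 : ℕ
    _≤P_              : Rel (Fin n) 0ℓ
    isDecPartialOrder : IsDecPartialOrder _≡_ _≤P_

  open IsDecPartialOrder isDecPartialOrder public using (_≤?_)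

  _<P_ : Rel (Fin n) 0ℓ
  x <P y = (x ≤P y) × (x ≢ y)

open FinPoset public

record IsLinExt (P : FinPoset) (S : Subset (n P)) (L : List (Fin (n P))) : Set where
  field
    unique   : Unique L
    elements : ∀ x → (x LMem.∈ L) ⇔ (x Sub.∈ S)
    order    : ∀ (a b : Fin (length L)) →
               _<P_ P (lookup L a) (lookup L b) → a Fin.< b

-- Bender–Knuth move t_i (i is 1-indexed): swap the entries in positions i, i+1
-- if they are incomparable in P, otherwise do nothing.
bk : (P : FinPoset) → ℕ → List (Fin (n P)) → List (Fin (n P))
bk P zero l = l
bk P (suc zero) (a ∷ b ∷ l) with _≤?_ P a b | _≤?_ P b a
... | no _  | no _ = b ∷ a ∷ l
... | _     | _    = a ∷ b ∷ l
bk P (suc zero) l = l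
bk P (suc (suc i)) [] = []
bk P (suc (suc i)) (a ∷ l) = a ∷ bk P (suc i) l

act : (P : FinPoset) → List ℕ → List (Fin (n P)) → List (Fin (n P))
act P [] l = l
act P (i ∷ w) l = bk P i (act P w l)

down : ℕ → List ℕ
down zero = []
down (suc j) = suc j ∷ down j

-- q_m = t_1 (t_2 t_1) ⋯ (t_m t_{m-1} ⋯ t_1)
q : ℕ → List ℕ
q zero = []
q (suc m) = q m ++ down (suc m)

qjk : ℕ → ℕ → List ℕ
qjk j k = q (k ∸ 1) ++ (q (k ∸ j) ++ q (k ∸ 1))

-- The induced subposet P|S is LE-cactus: (t_i q_{jk})² = 1 in BK_{P|S}, i.e. acts
-- as the identity on every linear extension, for all 2 ≤ i+1 < j < k ≤ |S|.
LECactusOn : (P : FinPoset) → Subset (n P) → Set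
LECactusOn P S =
  ∀ (i j k : ℕ) → 2 ℕ.≤ i + 1 → i + 1 ℕ.< j → j ℕ.< k → k ℕ.≤ Sub.∣ S ∣ →
  ∀ (L : List (Fin (n P))) → IsLinExt P S L →
  act P (i ∷ qjk j k) (act P (i ∷ qjk j k) L) ≡ L

LECactus : FinPoset → Set
LECactus P = LECactusOn P Sub.⊤

IsOrderIdeal : (P : FinPoset) → Subset (n P) → Set
IsOrderIdeal P I = ∀ x y → _≤P_ P y x → x Sub.∈ I → y Sub.∈ I

-- Restricting to an order ideal loses nothing: a linear extension L of an
-- ideal I followed by any linear extension M of its complement is a linear
-- extension of P, and every letter of the relation word t_i q_{jk} is
-- smaller than k ≤ |I| ≤ |L|, so the word only permutes the prefix L and
-- leaves M in place. Hence (t_i q_{jk})² fixes L as soon as it fixes L ++ M.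
-- Conversely P is itself an order ideal of P.
module Submission where

open import Defs
open import Data.Fin.Subset using (Subset)
open import Function using (_⇔_)

open import Data.Bool using (true; false)
open import Data.Empty using (⊥-elim)
open import Data.Fin as Fin using (Fin; zero; suc)
open import Data.Fin.Properties as FinP using (<-cmp)
import Data.Fin.Subset as Sub
import Data.Fin.Subset.Properties as SubP
open import Data.List using (List; []; _∷_; length; lookup; _++_; filter; allFin)
open import Data.List.Properties using (++-cancelʳ)
open import Data.List.Membership.Propositional using (_∈_)
import Data.List.Membership.Propositional.Properties as ∈P
import Data.List.Relation.Binary.Permutation.Propositional as Perm
import Data.List.Relation.Binary.Permutation.Propositional.Properties as PermP
import Data.List.Relation.Binary.Permutation.Setoid.Properties as PermSP
open import Data.List.Relation.Unary.All as All using (All; []; _∷_)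
import Data.List.Relation.Unary.All.Properties as AllP
open import Data.List.Relation.Unary.AllPairs as AllPairs using (AllPairs; []; _∷_)
import Data.List.Relation.Unary.AllPairs.Properties as AllPairsP
open import Data.List.Relation.Unary.Any using (here; there; index)
open import Data.List.Relation.Unary.Any.Properties using (lookup-index)
import Data.List.Relation.Unary.Linked.Properties as LinkedP
import Data.List.Relation.Unary.Unique.Propositional.Properties as UniqueP
import Data.List.Sort
open import Data.Nat using (ℕ; zero; suc; _≤_; _<_; z≤n; s≤s)
import Data.Nat.Properties as ℕP
open import Data.Product using (_×_; _,_; proj₁; proj₂; Σ)
open import Data.Vec as Vec using (_∷_)
open import Function using (mk⇔; _∘_)
open import Function.Bundles using (Equivalence)
open import Relation.Binary using (Rel; IsDecPartialOrder; tri<; tri≈; tri>)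
import Relation.Binary.Construct.On as On
open import Relation.Binary.PropositionalEquality
open import Relation.Nullary using (¬_; yes; no)

open Equivalence using (to; from)

remove : ∀ {m} → Subset m → Fin m → Subset m
remove (_ ∷ p) zero    = false ∷ p
remove (s ∷ p) (suc x) = s ∷ remove p x

∣p∣≤1+∣remove∣ : ∀ {m} (p : Subset m) x → Sub.∣ p ∣ ≤ suc Sub.∣ remove p x ∣
∣p∣≤1+∣remove∣ (true  ∷ p) zero    = ℕP.≤-refl
∣p∣≤1+∣remove∣ (false ∷ p) zero    = ℕP.n≤1+n _
∣p∣≤1+∣remove∣ (true  ∷ p) (suc x) = s≤s (∣p∣≤1+∣remove∣ p x)
∣p∣≤1+∣remove∣ (false ∷ p) (suc x) = ∣p∣≤1+∣remove∣ p x

∈-remove⁻ : ∀ {m} (p : Subset m) x {y} → y Sub.∈ remove p x → y Sub.∈ p × y ≢ x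
∈-remove⁻ (_ ∷ p) zero    {suc y} (Vec.there y∈p) = Vec.there y∈p , λ ()
∈-remove⁻ (_ ∷ p) (suc x) {zero}  Vec.here        = Vec.here , λ ()
∈-remove⁻ (_ ∷ p) (suc x) {suc y} (Vec.there y∈p) =
  let y∈p′ , y≢x = ∈-remove⁻ p x y∈p in Vec.there y∈p′ , y≢x ∘ FinP.suc-injective

∣p∣≤length : ∀ {m} (p : Subset m) (L : List (Fin m)) →
             (∀ {x} → x Sub.∈ p → x ∈ L) → Sub.∣ p ∣ ≤ length L
∣p∣≤length {m} p []      p⊆L = ℕP.≤-reflexive (begin
  Sub.∣ p ∣         ≡⟨ cong Sub.∣_∣ (SubP.Empty-unique (λ (_ , x∈p) → ∈P.∉[] (p⊆L x∈p))) ⟩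
  Sub.∣ Sub.⊥ {m} ∣ ≡⟨ SubP.∣⊥∣≡0 m ⟩
  0                 ∎)
  where open ≡-Reasoning
∣p∣≤length p (y ∷ L) p⊆L =
  ℕP.≤-trans (∣p∣≤1+∣remove∣ p y) (s≤s (∣p∣≤length (remove p y) L p-y⊆L))
  where
  p-y⊆L : ∀ {x} → x Sub.∈ remove p y → x ∈ L
  p-y⊆L x∈p-y with ∈-remove⁻ p y x∈p-y
  ... | x∈p , x≢y with p⊆L x∈p
  ...   | here x≡y   = ⊥-elim (x≢y x≡y)
  ...   | there x∈L = x∈L

down-letters≤ : ∀ m → All (_≤ m) (down m)
down-letters≤ zero    = []
down-letters≤ (suc m) = ℕP.≤-refl ∷ All.map ℕP.m≤n⇒m≤1+n (down-letters≤ m)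

q-letters≤ : ∀ m → All (_≤ m) (q m)
q-letters≤ zero    = []
q-letters≤ (suc m) =
  AllP.++⁺ (All.map ℕP.m≤n⇒m≤1+n (q-letters≤ m)) (down-letters≤ (suc m))

q-letters< : ∀ {m k} → m < k → All (_< k) (q m)
q-letters< m<k = All.map (λ l≤m → ℕP.≤-<-trans l≤m m<k) (q-letters≤ _)

relationWord-letters< : ∀ {i j k} → i < j → j < k → All (_< k) (i ∷ qjk j k)
relationWord-letters< {i} {suc j} {suc k} i<j j<k =
  ℕP.<-trans i<j j<k ∷
  AllP.++⁺ (q-letters< ℕP.≤-refl)
    (AllP.++⁺ (q-letters< (s≤s (ℕP.m∸n≤m k j))) (q-letters< ℕP.≤-refl))

module _ (P : FinPoset) where

  private
    E : Set
    E = Fin (n P)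

  open IsDecPartialOrder (isDecPartialOrder P)
    using () renaming (refl to ≤P-refl; trans to ≤P-trans; antisym to ≤P-antisym)

  bk-length : ∀ i (l : List E) → length (bk P i l) ≡ length l
  bk-length zero          l           = refl
  bk-length (suc zero)    []          = refl
  bk-length (suc zero)    (a ∷ [])    = refl
  bk-length (suc zero)    (a ∷ b ∷ l) with _≤?_ P a b | _≤?_ P b a
  ... | no _  | no _  = refl
  ... | yes _ | _     = refl
  ... | no _  | yes _ = refl
  bk-length (suc (suc i)) []          = refl
  bk-length (suc (suc i)) (a ∷ l)     = cong suc (bk-length (suc i) l)

  act-length : ∀ w (l : List E) → length (act P w l) ≡ length l
  act-length []      l = refl
  act-length (i ∷ w) l = trans (bk-length i (act P w l)) (act-length w l)

  bk-++ : ∀ i (L M : List E) → i < length L → bk P i (L ++ M) ≡ bk P i L ++ M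
  bk-++ zero          L           M _ = refl
  bk-++ (suc zero)    (a ∷ b ∷ l) M _ with _≤?_ P a b | _≤?_ P b a
  ... | no _  | no _  = refl
  ... | yes _ | _     = refl
  ... | no _  | yes _ = refl
  bk-++ (suc zero)    (a ∷ [])    M (s≤s ())
  bk-++ (suc (suc i)) (a ∷ l)     M (s≤s i<l) = cong (a ∷_) (bk-++ (suc i) l M i<l)

  act-++ : ∀ w (L M : List E) → All (_< length L) w → act P w (L ++ M) ≡ act P w L ++ M
  act-++ []      L M _           = refl
  act-++ (i ∷ w) L M (i<L ∷ w<L) = begin
    bk P i (act P w (L ++ M))   ≡⟨ cong (bk P i) (act-++ w L M w<L) ⟩
    bk P i (act P w L ++ M)     ≡⟨ bk-++ i (act P w L) M (subst (i <_) (sym (act-length w L)) i<L) ⟩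
    bk P i (act P w L) ++ M     ∎
    where open ≡-Reasoning

  act²-++ : ∀ w (L M : List E) → All (_< length L) w →
            act P w (act P w (L ++ M)) ≡ act P w (act P w L) ++ M
  act²-++ w L M w<L = begin
    act P w (act P w (L ++ M))  ≡⟨ cong (act P w) (act-++ w L M w<L) ⟩
    act P w (act P w L ++ M)    ≡⟨ act-++ w (act P w L) M w<wL ⟩
    act P w (act P w L) ++ M    ∎
    where
    open ≡-Reasoning
    w<wL : All (_< length (act P w L)) w
    w<wL = subst (λ ℓ → All (_< ℓ) w) (sym (act-length w L)) w<L

  _≯P_ : Rel E _
  x ≯P y = ¬ (_<P_ P y x)

  lookup-order⇒AllPairs : ∀ (L : List E) →
    (∀ (a b : Fin (length L)) → _<P_ P (lookup L a) (lookup L b) → a Fin.< b) →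
    AllPairs _≯P_ L
  lookup-order⇒AllPairs []      ord = []
  lookup-order⇒AllPairs (x ∷ L) ord =
    All.tabulate head-minimal ∷
    lookup-order⇒AllPairs L (λ a b a<b → ℕP.≤-pred (ord (suc a) (suc b) a<b))
    where
    head-minimal : ∀ {y} → y ∈ L → x ≯P y
    head-minimal y∈L y<x
      with () ← ord (suc (index y∈L)) zero (subst (λ z → _<P_ P z x) (lookup-index y∈L) y<x)

  AllPairs⇒lookup-order : ∀ (L : List E) → AllPairs _≯P_ L →
    ∀ (a b : Fin (length L)) → _<P_ P (lookup L a) (lookup L b) → a Fin.< b
  AllPairs⇒lookup-order L ap a b la<lb with <-cmp a b
  ... | tri< a<b _ _    = a<b
  ... | tri≈ _ refl _   = ⊥-elim (proj₂ la<lb refl)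
  ... | tri> _ _ b<a    = ⊥-elim (lookup-AllPairs L ap b a b<a la<lb)
    where
    lookup-AllPairs : ∀ (L : List E) → AllPairs _≯P_ L →
                      ∀ (a b : Fin (length L)) → a Fin.< b → lookup L a ≯P lookup L b
    lookup-AllPairs (x ∷ L) (x≯L ∷ _)  zero    (suc b) _         = All.lookup x≯L (∈P.∈-lookup b)
    lookup-AllPairs (x ∷ L) (_ ∷ L≯L) (suc a) (suc b) (s≤s a<b) = lookup-AllPairs L L≯L a b a<b

  belowCount : E → List E → ℕ
  belowCount x []       = 0
  belowCount x (z ∷ zs) with _≤?_ P z x
  ... | yes _ = suc (belowCount x zs)
  ... | no _  = belowCount x zs

  belowCount-mono : ∀ {x y} → _≤P_ P x y → ∀ zs → belowCount x zs ≤ belowCount y zs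
  belowCount-mono x≤y []       = z≤n
  belowCount-mono {x} {y} x≤y (z ∷ zs) with _≤?_ P z x | _≤?_ P z y
  ... | yes _   | yes _   = s≤s (belowCount-mono x≤y zs)
  ... | yes z≤x | no z≰y  = ⊥-elim (z≰y (≤P-trans z≤x x≤y))
  ... | no _    | yes _   = ℕP.m≤n⇒m≤1+n (belowCount-mono x≤y zs)
  ... | no _    | no _    = belowCount-mono x≤y zs

  belowCount-strict : ∀ {x y} → _≤P_ P x y → ¬ _≤P_ P y x →
                      ∀ {zs} → y ∈ zs → belowCount x zs < belowCount y zs
  belowCount-strict {x} {y} x≤y y≰x {z ∷ zs} y∈zs with _≤?_ P z x | _≤?_ P z y | y∈zs
  ... | yes z≤x | _       | here refl  = ⊥-elim (y≰x z≤x)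
  ... | yes _   | yes _   | there y∈zs = s≤s (belowCount-strict x≤y y≰x y∈zs)
  ... | yes z≤x | no z≰y  | _          = ⊥-elim (z≰y (≤P-trans z≤x x≤y))
  ... | no _    | yes _   | _          = s≤s (belowCount-mono x≤y zs)
  ... | no _    | no z≰y  | here refl  = ⊥-elim (z≰y ≤P-refl)
  ... | no _    | no _    | there y∈zs = belowCount-strict x≤y y≰x y∈zs

  ∣↓_∣ : E → ℕ
  ∣↓ x ∣ = belowCount x (allFin (n P))

  ∣↓∣-strictMono : ∀ {x y} → _<P_ P x y → ∣↓ x ∣ < ∣↓ y ∣
  ∣↓∣-strictMono {x} {y} (x≤y , x≢y) =
    belowCount-strict x≤y (λ y≤x → x≢y (≤P-antisym x≤y y≤x)) (∈P.∈-allFin y)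

  -- Sorting by the size of the principal down-set is a linear extension.
  linExt : ∀ (S : Subset (n P)) → Σ (List E) (IsLinExt P S)
  linExt S = sort xs , record
    { unique   = PermSP.Unique-resp-↭ (setoid E) (Perm.↭⇒↭ₛ (Perm.↭-sym (sort-↭ xs)))
                   (UniqueP.filter⁺ (SubP._∈? S) (UniqueP.allFin⁺ (n P)))
    ; elements = λ x → mk⇔ (sorted⁻ x) (sorted⁺ x)
    ; order    = AllPairs⇒lookup-order (sort xs) sorted-AllPairs
    }
    where
    open Data.List.Sort (On.decTotalOrder ℕP.≤-decTotalOrder ∣↓_∣) using (sort; sort-↭; sort-↗)

    xs : List E
    xs = filter (SubP._∈? S) (allFin (n P))

    sorted⁻ : ∀ x → x ∈ sort xs → x Sub.∈ S
    sorted⁻ x x∈ = proj₂ (∈P.∈-filter⁻ (SubP._∈? S) {xs = allFin (n P)} (PermP.∈-resp-↭ (sort-↭ xs) x∈))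

    sorted⁺ : ∀ x → x Sub.∈ S → x ∈ sort xs
    sorted⁺ x x∈S = PermP.∈-resp-↭ (Perm.↭-sym (sort-↭ xs)) (∈P.∈-filter⁺ (SubP._∈? S) (∈P.∈-allFin x) x∈S)

    sorted-AllPairs : AllPairs _≯P_ (sort xs)
    sorted-AllPairs = AllPairs.map (λ {x} {y} ∣↓x∣≤∣↓y∣ y<x → ℕP.<⇒≱ (∣↓∣-strictMono y<x) ∣↓x∣≤∣↓y∣)
                        (LinkedP.Linked⇒AllPairs ℕP.≤-trans (sort-↗ xs))

  linExt-++ : ∀ {I L M} → IsOrderIdeal P I →
              IsLinExt P I L → IsLinExt P (Sub.∁ I) M → IsLinExt P Sub.⊤ (L ++ M)
  linExt-++ {I} {L} {M} ideal extL extM = record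
    { unique   = UniqueP.++⁺ (IsLinExt.unique extL) (IsLinExt.unique extM)
                   (λ (x∈L , x∈M) → SubP.x∈p⇒x∉∁p (inI x∈L) (inI∁ x∈M))
    ; elements = λ x → mk⇔ (λ _ → SubP.∈⊤) (λ _ → everywhere x)
    ; order    = AllPairs⇒lookup-order (L ++ M)
                   (AllPairsP.++⁺ (lookup-order⇒AllPairs L (IsLinExt.order extL))
                                  (lookup-order⇒AllPairs M (IsLinExt.order extM))
                                  (All.tabulate λ x∈L → All.tabulate λ y∈M y<x →
                                    SubP.x∈p⇒x∉∁p (ideal _ _ (proj₁ y<x) (inI x∈L)) (inI∁ y∈M)))
    }
    where
    inI : ∀ {x} → x ∈ L → x Sub.∈ I
    inI = to (IsLinExt.elements extL _)

    inI∁ : ∀ {x} → x ∈ M → x Sub.∈ Sub.∁ I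
    inI∁ = to (IsLinExt.elements extM _)

    everywhere : ∀ x → x ∈ L ++ M
    everywhere x with x SubP.∈? I
    ... | yes x∈I = ∈P.∈-++⁺ˡ (from (IsLinExt.elements extL x) x∈I)
    ... | no x∉I  = ∈P.∈-++⁺ʳ L (from (IsLinExt.elements extM x) (SubP.x∉p⇒x∈∁p x∉I))

  linExt-∣S∣≤length : ∀ {S L} → IsLinExt P S L → Sub.∣ S ∣ ≤ length L
  linExt-∣S∣≤length {S} {L} ext = ∣p∣≤length S L (from (IsLinExt.elements ext _))

  LECactus⇒LECactusOn-ideal : LECactus P →
    ∀ (I : Subset (n P)) → IsOrderIdeal P I → LECactusOn P I
  LECactus⇒LECactusOn-ideal cactus I ideal i j k 0<i i+1<j j<k k≤∣I∣ L extL =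
    ++-cancelʳ M _ _ (begin
      act P w (act P w L) ++ M     ≡⟨ act²-++ w L M w<L ⟨
      act P w (act P w (L ++ M))   ≡⟨ cactus i j k 0<i i+1<j j<k k≤n (L ++ M) (linExt-++ ideal extL extM) ⟩
      L ++ M                       ∎)
    where
    open ≡-Reasoning
    w : List ℕ
    w = i ∷ qjk j k

    M : List (Fin (n P))
    M = proj₁ (linExt (Sub.∁ I))

    extM : IsLinExt P (Sub.∁ I) M
    extM = proj₂ (linExt (Sub.∁ I))

    w<L : All (_< length L) w
    w<L = All.map (λ l<k → ℕP.<-≤-trans l<k (ℕP.≤-trans k≤∣I∣ (linExt-∣S∣≤length extL)))
            (relationWord-letters< (ℕP.<-trans (ℕP.m<m+n i (s≤s z≤n)) i+1<j) j<k)

    k≤n : k ≤ Sub.∣ Sub.⊤ {n P} ∣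
    k≤n = subst (k ≤_) (sym (SubP.∣⊤∣≡n (n P))) (ℕP.≤-trans k≤∣I∣ (SubP.∣p∣≤n I))

⊤-isOrderIdeal : ∀ (P : FinPoset) → IsOrderIdeal P Sub.⊤
⊤-isOrderIdeal P _ _ _ _ = SubP.∈⊤

proposition3p12 : (P : FinPoset) →
    LECactus P ⇔ (∀ (I : Subset (n P)) → IsOrderIdeal P I → LECactusOn P I)
proposition3p12 P =
  mk⇔ (LECactus⇒LECactusOn-ideal P) (λ cactusOnIdeals → cactusOnIdeals Sub.⊤ (⊤-isOrderIdeal P))
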